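{- Let $\mathcal N$ be an $n$-level $\Pi^3$-net, let $2\le i\le n$ and let $m$ be a marking with $\varphi_i(m)\le m(P_{i-1})$. Then $\varphi_i(m')\le m'(P_{i-1})$ for every $m'\in\mathcal R(m)$.
   Context: A Petri net is $(P,T,W^-,W^+)$ with $W^-,W^+\in\mathbb N^{P\times T}$; ${}^\bullet t,t^\bullet$ the columns of $W^-,W^+$. Markings $m\in\mathbb N^P$, enabling ($m\ge{}^\bullet t$), firing ($m\mapsto m-{}^\bullet t+t^\bullet$), reachability set $\mathcal R(m)$ as usual; $m(P')=\sum_{p\in P'}m(p)$. Weakly reversible: every connected component of the reaction graph (nodes $\{{}^\bullet t\}\cup\{t^\bullet\}$, arcs $({}^\bullet t,t^\bullet)$) is strongly connected. For $n\ge2$, an $n$-level ordered $\Pi$-net is a weakly reversible net with partitions $P=P_1\sqcup\dots\sqcup P_n$, $T=T_1\sqcup\dots\sqcup T_n$ such that: (1) each $P_i\ne\emptyset$; (2) $(P_i,T_i,W^-|_{P_i\times T_i},W^+|_{P_i\times T_i})$ is a strongly connected state machine (each transition of $T_i$ has exactly one input and one output place in $P_i$, with weight $1$); (3) for $t\in T_i$, ${}^\bullet t(p)>0$ implies $p\in P_i\cup P_{i-1}$ ($P_0=\emptyset$); (4) for $2\le i\le n$ some $t\in T_i$, $p\in P_{i-1}$ have ${}^\bullet t(p)>0$; (5) for $t,t'\in T_i$, if ${}^\bullet t$ and ${}^\bullet t'$ share a place of $P_i$ then ${}^\bullet t={}^\bullet t'$. Potentials: for $p\in P_i$ ($i\ge2$),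 $q\in P_{i-1}$, $pot(p,q)=t^\bullet(q)$ if some $t\in T_i$ has $t^\bullet(p)>0$ and $t^\bullet(q)>0$ (independent of $t$), else $0$; $pot(p)=\sum_{q\in P_{i-1}}pot(p,q)$ for $p\in P_i$, $i\ge2$, and $pot(p)=0$ for $p\in P_1$. A $\Pi^3$-net is an ordered $\Pi$-net such that for every $1\le i\le n-1$ and every $p\in P_i$ with ${}^\bullet t(p)>0$ for some $t\in T_{i+1}$, $pot(p)=\max\{pot(q):q\in P_i\}$. For $2\le i\le n$, $\varphi_i(m)=\max\{pot(p):p\in P_i\}$ if $m(P_i)=0$, and $\varphi_i(m)=\min\{pot(p):p\in P_i,\ m(p)>0\}$ if $m(P_i)>0$. -}

module Defs where

open import Data.Nat using (ℕ; zero; suc; _+_; _∸_; _≤_; _<_; _⊔_; _⊓_; _≡ᵇ_)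
open import Data.Fin using (Fin)
open import Data.Bool using (Bool; true; false; if_then_else_; _∧_; not)
open import Data.Maybe using (Maybe; just; nothing)
open import Data.Product using (Σ; ∃; _×_; _,_)
open import Data.Sum using (_⊎_)
open import Relation.Binary.PropositionalEquality using (_≡_; _≢_)

sumWhere : ∀ {k} → (Fin k → Bool) → (Fin k → ℕ) → ℕ
sumWhere {zero}  P f = 0
sumWhere {suc k} P f =
  (if P Fin.zero then f Fin.zero else 0) + sumWhere (λ x → P (Fin.suc x)) (λ x → f (Fin.suc x))

-- maximum of f over {x | P x}; 0 if that set is empty
maxWhere : ∀ {k} → (Fin k → Bool) → (Fin k → ℕ) → ℕ
maxWhere {zero}  P f = 0
maxWhere {suc k} P f =
  (if P Fin.zero then f Fin.zero else 0) ⊔ maxWhere (λ x → P (Fin.suc x)) (λ x → f (Fin.suc x))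

minWhere : ∀ {k} → (Fin k → Bool) → (Fin k → ℕ) → Maybe ℕ
minWhere {zero}  P f = nothing
minWhere {suc k} P f with minWhere (λ x → P (Fin.suc x)) (λ x → f (Fin.suc x))
... | nothing = if P Fin.zero then just (f Fin.zero) else nothing
... | just v  = if P Fin.zero then just (f Fin.zero ⊓ v) else just v

-- Petri nets: places Fin np, transitions Fin nt,
-- pre p t = W⁻(p,t) = •t(p),  post p t = W⁺(p,t) = t•(p)

record Net : Set where
  field
    np   : ℕ
    nt   : ℕ
    pre  : Fin np → Fin nt → ℕ
    post : Fin np → Fin nt → ℕ

module _ (N : Net) where
  open Net N

  Marking : Set
  Marking = Fin np → ℕ

  Enabled : Marking → Fin nt → Set
  Enabled m t = ∀ p → pre p t ≤ m p

  fire : Marking → Fin nt → Marking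
  fire m t p = m p ∸ pre p t + post p t

  data Reach (m : Marking) : Marking → Set where
    here : Reach m m
    step : ∀ {m'} t → Reach m m' → Enabled m' t → Reach m (fire m' t)

  -- Nodes are the complexes •t and t•; a node is named by
  -- (t , b) with b = true for •t and b = false for t•; two names denote the
  -- same node iff the complexes are equal (pointwise).

  Node : Set
  Node = Fin nt × Bool

  cplx : Node → Marking
  cplx (t , true)  = λ p → pre p t
  cplx (t , false) = λ p → post p t

  SameCplx : Node → Node → Set
  SameCplx x y = ∀ p → cplx x p ≡ cplx y p

  Arc : Node → Node → Set
  Arc x y = ∃ λ t → SameCplx x (t , true) × SameCplx y (t , false)

  data DPath : Node → Node → Set where
    dnil  : ∀ {x y} → SameCplx x y → DPath x y
    dcons : ∀ {x y z} → Arc x y → DPath y z → DPath x z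

  data UPath : Node → Node → Set where
    unil  : ∀ {x y} → SameCplx x y → UPath x y
    ucons : ∀ {x y z} → (Arc x y ⊎ Arc y x) → UPath y z → UPath x z

  WeaklyReversible : Set
  WeaklyReversible = ∀ x y → UPath x y → DPath x y

  -- Ordered Π-nets. Levels are numbered 1..n:
  -- p ∈ P_i  iff  lvl p ≡ i,   t ∈ T_i  iff  tlvl t ≡ i.

  module Levels (n : ℕ) (lvl : Fin np → ℕ) (tlvl : Fin nt → ℕ) where

    inP : ℕ → Fin np → Bool
    inP i p = lvl p ≡ᵇ i

    mP : Marking → ℕ → ℕ
    mP m i = sumWhere (inP i) m

    data SMPath (i : ℕ) : Fin np → Fin np → Set where
      snil  : ∀ {p} → SMPath i p p
      scons : ∀ {p q r} t → tlvl t ≡ i → 0 < pre p t → 0 < post q t →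
              lvl q ≡ i → SMPath i q r → SMPath i p r

    record IsOrderedPi : Set where
      field
        two≤n     : 2 ≤ n
        weakRev   : WeaklyReversible
        lvl-range  : ∀ p → 1 ≤ lvl p × lvl p ≤ n
        tlvl-range : ∀ t → 1 ≤ tlvl t × tlvl t ≤ n
        nonempty  : ∀ i → 1 ≤ i → i ≤ n → ∃ λ p → lvl p ≡ i
        sm-in     : ∀ t → ∃ λ p → lvl p ≡ tlvl t × pre p t ≡ 1 ×
                      (∀ q → lvl q ≡ tlvl t → q ≢ p → pre q t ≡ 0)
        sm-out    : ∀ t → ∃ λ p → lvl p ≡ tlvl t × post p t ≡ 1 ×
                      (∀ q → lvl q ≡ tlvl t → q ≢ p → post q t ≡ 0)
        sm-sc     : ∀ p q → lvl p ≡ lvl q → SMPath (lvl p) p q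
        pre-lvl   : ∀ t p → 0 < pre p t → lvl p ≡ tlvl t ⊎ suc (lvl p) ≡ tlvl t
        link      : ∀ i → 2 ≤ i → i ≤ n →
                      ∃ λ t → ∃ λ p → tlvl t ≡ i × suc (lvl p) ≡ i × 0 < pre p t
        same-pre  : ∀ t t' p → tlvl t ≡ tlvl t' → lvl p ≡ tlvl t →
                      0 < pre p t → 0 < pre p t' → ∀ q → pre q t ≡ pre q t'

    -- pot(p,q): t•(q) for a t ∈ T_{lvl p} with t•(p) > 0 and t•(q) > 0
    -- (taken as the maximum over such t; the paper notes it is independent of t),
    -- 0 if there is no such t.
    potPQ : Fin np → Fin np → ℕ
    potPQ p q = maxWhere
      (λ t → (tlvl t ≡ᵇ lvl p) ∧ not (post p t ≡ᵇ 0) ∧ not (post q t ≡ᵇ 0))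
      (λ t → post q t)

    pot : Fin np → ℕ
    pot p = sumWhere (λ q → suc (lvl q) ≡ᵇ lvl p) (potPQ p)

    maxPot : ℕ → ℕ
    maxPot i = maxWhere (inP i) pot

    record IsPi3 : Set where
      field
        ordered : IsOrderedPi
        pi3     : ∀ i → 1 ≤ i → suc i ≤ n → ∀ p → lvl p ≡ i →
                    (∃ λ t → tlvl t ≡ suc i × 0 < pre p t) → pot p ≡ maxPot i

    φ : ℕ → Marking → ℕ
    φ i m with mP m i ≡ᵇ 0 | minWhere (λ p → inP i p ∧ not (m p ≡ᵇ 0)) pot
    ... | true  | _       = maxPot i
    ... | false | just v  = v
    ... | false | nothing = 0   -- impossible case (m(P_i) > 0)

-- Write i = j + 1 and argue along a firing sequence. A transition t of T_i puts a token on
-- some p ∈ P_i, so afterwards φ_i ≤ pot p = Σ_q pot(p,q) ≤ Σ_q t•(q) ≤ m'(P_{i-1}).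
-- Any other transition does not increase φ_i: a place of P_i loses tokens only through
-- T_i or T_{i+1}, and a place feeding T_{i+1} has maximal potential by the Π³ condition.
-- Nor does it decrease m(P_{i-1}): a transition of T_{i-1} takes one token from P_{i-1}
-- and returns one, and apart from T_{i-1} only T_i consumes from P_{i-1}. That pot(p,q)
-- does not depend on the chosen t comes from weak reversibility: t• is the input complex
-- of a transition of the same level, to which condition (5) applies.

module Submission where

open import Defs
open import Data.Bool using (Bool; true; false; T; not; _∧_; if_then_else_)
open import Data.Bool.Properties using (T-≡; T-∧)
open import Data.Fin using (Fin) renaming (zero to fzero; suc to fsuc)
open import Data.Fin.Properties using () renaming (suc-injective to fsuc-injective)
open import Data.Maybe using (Maybe; just; nothing)
open import Data.Nat using (ℕ; zero; suc; _+_; _∸_; _≤_; _<_; _⊓_; _≡ᵇ_; z≤n; s≤s; _≟_)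
open import Data.Nat.Properties
  using ( ≡ᵇ⇒≡; ≡⇒≡ᵇ; ≤-refl; ≤-reflexive; ≤-trans; ≤-antisym; <-≤-trans; <⇒≱; ≮⇒≥; n≤1+n
        ; m≤m+n; m≤n+m; +-identityʳ; +-mono-≤; +-monoʳ-≤; +-cancelʳ-≤; m∸n+n≡m
        ; ⊔-lub; m≤m⊔n; m≤n⊔m; ⊓-sel; m⊓n≤m; m⊓n≤n; +-commutativeSemigroup; module ≤-Reasoning )
open import Algebra.Properties.CommutativeSemigroup +-commutativeSemigroup
  using (interchange; xy∙z≈xz∙y)
open import Data.Product using (∃; _×_; _,_; proj₁; proj₂)
open import Data.Sum using (inj₁; inj₂; [_,_]′)
open import Function.Bundles using (module Equivalence)
open import Relation.Nullary using (¬_; yes; no; contradiction)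
open import Relation.Binary.PropositionalEquality

open Equivalence using (to; from)

one-pos : ∀ {x} → x ≡ 1 → 0 < x
one-pos refl = s≤s z≤n

T-nonzero⇒0< : ∀ x → T (not (x ≡ᵇ 0)) → 0 < x
T-nonzero⇒0< (suc x) _ = s≤s z≤n

0<⇒T-nonzero : ∀ {x} → 0 < x → T (not (x ≡ᵇ 0))
0<⇒T-nonzero (s≤s _) = _

sumWhere-mono : ∀ {k} (P : Fin k → Bool) {f g : Fin k → ℕ} →
                (∀ x → T (P x) → f x ≤ g x) → sumWhere P f ≤ sumWhere P g
sumWhere-mono {zero}  P h = z≤n
sumWhere-mono {suc k} P {f} {g} h =
  +-mono-≤ head (sumWhere-mono (λ x → P (fsuc x)) (λ x → h (fsuc x)))
  where
  head : (if P fzero then f fzero else 0) ≤ (if P fzero then g fzero else 0)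
  head with P fzero | h fzero
  ... | true  | le = le _
  ... | false | _  = z≤n

sumWhere-cong : ∀ {k} (P : Fin k → Bool) {f g : Fin k → ℕ} →
                (∀ x → T (P x) → f x ≡ g x) → sumWhere P f ≡ sumWhere P g
sumWhere-cong P h = ≤-antisym (sumWhere-mono P (λ x px → ≤-reflexive (h x px)))
                              (sumWhere-mono P (λ x px → ≤-reflexive (sym (h x px))))

sumWhere-+ : ∀ {k} (P : Fin k → Bool) (f g : Fin k → ℕ) →
             sumWhere P (λ x → f x + g x) ≡ sumWhere P f + sumWhere P g
sumWhere-+ {zero}  P f g = refl
sumWhere-+ {suc k} P f g
  rewrite sumWhere-+ (λ x → P (fsuc x)) (λ x → f (fsuc x)) (λ x → g (fsuc x))
  with P fzero
... | true  = interchange (f fzero) (g fzero) _ _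
... | false = refl

sumWhere-zero : ∀ {k} (P : Fin k → Bool) {f : Fin k → ℕ} →
                (∀ x → T (P x) → f x ≡ 0) → sumWhere P f ≡ 0
sumWhere-zero {zero}  P h = refl
sumWhere-zero {suc k} P {f} h = cong₂ _+_ head (sumWhere-zero (λ x → P (fsuc x)) (λ x → h (fsuc x)))
  where
  head : (if P fzero then f fzero else 0) ≡ 0
  head with P fzero | h fzero
  ... | true  | z = z _
  ... | false | _ = refl

≤-sumWhere : ∀ {k} (P : Fin k → Bool) (f : Fin k → ℕ) x → T (P x) → f x ≤ sumWhere P f
≤-sumWhere P f fzero px with P fzero
... | true = m≤m+n (f fzero) _
≤-sumWhere P f (fsuc x) px =
  ≤-trans (≤-sumWhere (λ y → P (fsuc y)) (λ y → f (fsuc y)) x px) (m≤n+m _ _)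

sumWhere-≤-single : ∀ {k} (P : Fin k → Bool) (f : Fin k → ℕ) x →
                    (∀ y → y ≢ x → T (P y) → f y ≡ 0) → sumWhere P f ≤ f x
sumWhere-≤-single P f fzero h
  rewrite sumWhere-zero (λ y → P (fsuc y)) (λ y → h (fsuc y) λ ())
  with P fzero
... | true  = ≤-reflexive (+-identityʳ (f fzero))
... | false = z≤n
sumWhere-≤-single {suc k} P f (fsuc x) h =
  ≤-trans (≤-reflexive (cong (_+ sumWhere P′ f′) head))
          (sumWhere-≤-single P′ f′ x (λ y y≢x → h (fsuc y) (λ e → y≢x (fsuc-injective e))))
  where
  P′ : Fin k → Bool
  P′ y = P (fsuc y)
  f′ : Fin k → ℕ
  f′ y = f (fsuc y)
  head : (if P fzero then f fzero else 0) ≡ 0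
  head with P fzero | h fzero (λ ())
  ... | true  | z = z _
  ... | false | _ = refl

≤-maxWhere : ∀ {k} (P : Fin k → Bool) (f : Fin k → ℕ) x → T (P x) → f x ≤ maxWhere P f
≤-maxWhere P f fzero px with P fzero
... | true = m≤m⊔n (f fzero) _
≤-maxWhere P f (fsuc x) px =
  ≤-trans (≤-maxWhere (λ y → P (fsuc y)) (λ y → f (fsuc y)) x px) (m≤n⊔m _ _)

maxWhere-lub : ∀ {k} (P : Fin k → Bool) {f : Fin k → ℕ} {c} →
               (∀ x → T (P x) → f x ≤ c) → maxWhere P f ≤ c
maxWhere-lub {zero}  P h = z≤n
maxWhere-lub {suc k} P {f} {c} h = ⊔-lub head (maxWhere-lub (λ x → P (fsuc x)) (λ x → h (fsuc x)))
  where
  head : (if P fzero then f fzero else 0) ≤ c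
  head with P fzero | h fzero
  ... | true  | le = le _
  ... | false | _  = z≤n

data MinWhere {k} (P : Fin k → Bool) (f : Fin k → ℕ) : Maybe ℕ → Set where
  none : (∀ x → ¬ T (P x)) → MinWhere P f nothing
  some : ∀ {v} x → T (P x) → v ≡ f x → (∀ y → T (P y) → v ≤ f y) → MinWhere P f (just v)

minWhere-spec : ∀ {k} (P : Fin k → Bool) (f : Fin k → ℕ) → MinWhere P f (minWhere P f)
minWhere-spec {zero}  P f = none λ ()
minWhere-spec {suc k} P f
  with minWhere (λ x → P (fsuc x)) (λ x → f (fsuc x))
     | minWhere-spec (λ x → P (fsuc x)) (λ x → f (fsuc x))
... | nothing | none ¬P′ with P fzero in e
...   | true  = some fzero (subst T (sym e) _) refl
                  λ { fzero _ → ≤-refl ; (fsuc y) p → contradiction p (¬P′ y) }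
...   | false = none λ { fzero p → subst T e p ; (fsuc y) → ¬P′ y }
minWhere-spec {suc k} P f | just w | some x px w≡ w≤ with P fzero in e
...   | false = some (fsuc x) px w≡
                  λ { fzero p → contradiction (subst T e p) λ () ; (fsuc y) → w≤ y }
...   | true = [ (λ eq → some fzero (subst T (sym e) _) eq lower)
               , (λ eq → some (fsuc x) px (trans eq w≡) lower)
               ]′ (⊓-sel (f fzero) w)
  where
  lower : ∀ y → T (P y) → f fzero ⊓ w ≤ f y
  lower fzero    _ = m⊓n≤m (f fzero) w
  lower (fsuc y) p = ≤-trans (m⊓n≤n (f fzero) w) (w≤ y p)

module _ (N : Net) where
  open Net N

  fire+pre≡m+post : ∀ {m t} → Enabled N m t → ∀ p → fire N m t p + pre p t ≡ m p + post p t
  fire+pre≡m+post {m} {t} en p = begin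
    m p ∸ pre p t + post p t + pre p t ≡⟨ xy∙z≈xz∙y (m p ∸ pre p t) (post p t) (pre p t) ⟩
    m p ∸ pre p t + pre p t + post p t ≡⟨ cong (_+ post p t) (m∸n+n≡m (en p)) ⟩
    m p + post p t                     ∎
    where open ≡-Reasoning

  post≤fire : ∀ m t p → post p t ≤ fire N m t p
  post≤fire m t p = m≤n+m (post p t) (m p ∸ pre p t)

  unconsumed≤fire : ∀ m t p → pre p t ≡ 0 → m p ≤ fire N m t p
  unconsumed≤fire m t p pre≡0 rewrite pre≡0 = m≤m+n (m p) (post p t)

module _ (N : Net) (n : ℕ) (lvl : Fin (Net.np N) → ℕ) (tlvl : Fin (Net.nt N) → ℕ) where
  open Net N
  open Levels N n lvl tlvl

  module _ (Π : IsOrderedPi) where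
    open IsOrderedPi Π

    pre⇒lvl≤tlvl : ∀ t p → 0 < pre p t → lvl p ≤ tlvl t
    pre⇒lvl≤tlvl t p pos with pre-lvl t p pos
    ... | inj₁ e = ≤-reflexive e
    ... | inj₂ e = subst (lvl p ≤_) e (n≤1+n (lvl p))

    pre≡0-unlessAdjacent : ∀ t p → tlvl t ≢ lvl p → tlvl t ≢ suc (lvl p) → pre p t ≡ 0
    pre≡0-unlessAdjacent t p ≢lvl ≢suc with pre p t in e
    ... | zero  = refl
    ... | suc _ with pre-lvl t p (subst (0 <_) (sym e) (s≤s z≤n))
    ...   | inj₁ eq = contradiction (sym eq) ≢lvl
    ...   | inj₂ eq = contradiction (sym eq) ≢suc

    -- Arcs preserve Above j, since a transition's output place in its own level lies at least
    -- as high as its inputs; but •t is never above tlvl t, and t• is joined to •t by a path.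
    Above : ℕ → Node N → Set
    Above j x = ∃ λ p → 0 < cplx N x p × j < lvl p

    Above-arc : ∀ {j x y} → Arc N x y → Above j x → Above j y
    Above-arc {j} (t , x≈•t , y≈t•) (p , pos , j<p) with sm-out t
    ... | q , lq≡ , post≡1 , _ =
      q , subst (0 <_) (sym (y≈t• q)) (one-pos post≡1) ,
      subst (j <_) (sym lq≡) (<-≤-trans j<p (pre⇒lvl≤tlvl t p (subst (0 <_) (x≈•t p) pos)))

    Above-path : ∀ {j x y} → DPath N x y → Above j x → Above j y
    Above-path (dnil x≈y)   (p , pos , j<p) = p , subst (0 <_) (x≈y p) pos , j<p
    Above-path {j} {x} (dcons {y = y} a as) above = Above-path as (Above-arc {j} {x} {y} a above)

    ¬Above-pre : ∀ t → ¬ Above (tlvl t) (t , true)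
    ¬Above-pre t (p , pos , lt) = <⇒≱ lt (pre⇒lvl≤tlvl t p pos)

    return-path : ∀ t → DPath N (t , false) (t , true)
    return-path t = weakRev (t , false) (t , true)
      (ucons {y = t , true} (inj₂ (t , (λ _ → refl) , (λ _ → refl))) (unil (λ _ → refl)))

    post⇒lvl≤tlvl : ∀ t p → 0 < post p t → lvl p ≤ tlvl t
    post⇒lvl≤tlvl t p pos = ≮⇒≥ λ lt → ¬Above-pre t (Above-path (return-path t) (p , pos , lt))

    output-as-input : ∀ t → ∃ λ t′ → ∀ p → post p t ≡ pre p t′
    output-as-input t with return-path t
    ... | dnil t•≈•t                = t , t•≈•t
    ... | dcons (t′ , t•≈•t′ , _) _ = t′ , t•≈•t′

    output-as-input-sameLevel : ∀ t → ∃ λ t′ → tlvl t′ ≡ tlvl t × (∀ p → post p t ≡ pre p t′)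
    output-as-input-sameLevel t with output-as-input t | sm-out t
    ... | t′ , t•≈•t′ | s , ls , post≡1 , _ with sm-in t′
    ... | r , lr , pre≡1 , _ = t′ , ≤-antisym t′≤t t≤t′ , t•≈•t′
      where
      t′≤t : tlvl t′ ≤ tlvl t
      t′≤t = subst (_≤ tlvl t) lr
               (post⇒lvl≤tlvl t r (subst (0 <_) (sym (t•≈•t′ r)) (one-pos pre≡1)))
      t≤t′ : tlvl t ≤ tlvl t′
      t≤t′ = subst (_≤ tlvl t′) ls (pre⇒lvl≤tlvl t′ s (subst (0 <_) (t•≈•t′ s) (one-pos post≡1)))

    same-post : ∀ t t′ p → tlvl t ≡ tlvl t′ → lvl p ≡ tlvl t →
                0 < post p t → 0 < post p t′ → ∀ q → post q t ≡ post q t′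
    same-post t t′ p t≡t′ lp pos pos′ q
      with output-as-input-sameLevel t | output-as-input-sameLevel t′
    ... | u , lu , t•≈•u | u′ , lu′ , t′•≈•u′ = begin
      post q t  ≡⟨ t•≈•u q ⟩
      pre q u   ≡⟨ same-pre u u′ p (trans lu (trans t≡t′ (sym lu′))) (trans lp (sym lu))
                     (subst (0 <_) (t•≈•u p) pos) (subst (0 <_) (t′•≈•u′ p) pos′) q ⟩
      pre q u′  ≡⟨ t′•≈•u′ q ⟨
      post q t′ ∎
      where open ≡-Reasoning

    -- pot(p,q) is defined as a maximum over all admissible t; by same-post they all agree.
    potPQ≤post : ∀ t p q → lvl p ≡ tlvl t → 0 < post p t → potPQ p q ≤ post q t
    potPQ≤post t p q lp pos = maxWhere-lub _ bound
      where
      bound : ∀ t′ → T ((tlvl t′ ≡ᵇ lvl p) ∧ not (post p t′ ≡ᵇ 0) ∧ not (post q t′ ≡ᵇ 0)) →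
              post q t′ ≤ post q t
      bound t′ c with to T-∧ c
      ... | t′∈ , c′ = ≤-reflexive (same-post t′ t p (trans lt′ lp) (sym lt′)
                                     (T-nonzero⇒0< _ (proj₁ (to T-∧ c′))) pos q)
        where
        lt′ : tlvl t′ ≡ lvl p
        lt′ = ≡ᵇ⇒≡ _ _ t′∈

    mP-fire-ownLevel : ∀ {m t} j → Enabled N m t → tlvl t ≡ j → mP m j ≤ mP (fire N m t) j
    mP-fire-ownLevel {m} {t} j en refl with sm-in t | sm-out t
    ... | s , _ , pre≡1 , others | s′ , ls′ , post≡1 , _ = +-cancelʳ-≤ 1 _ _ (begin
      mP m j + 1                                 ≤⟨ +-monoʳ-≤ (mP m j) Σpost≥1 ⟩
      mP m j + sumWhere (inP j) (λ q → post q t) ≡⟨ balance ⟨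
      mP m′ j + sumWhere (inP j) (λ q → pre q t) ≤⟨ +-monoʳ-≤ (mP m′ j) Σpre≤1 ⟩
      mP m′ j + 1                                ∎)
      where
      open ≤-Reasoning
      m′ : Marking N
      m′ = fire N m t
      balance : mP m′ j + sumWhere (inP j) (λ q → pre q t) ≡
                mP m j + sumWhere (inP j) (λ q → post q t)
      balance = trans (sym (sumWhere-+ (inP j) m′ (λ q → pre q t)))
                      (trans (sumWhere-cong (inP j) (λ q _ → fire+pre≡m+post N en q))
                             (sumWhere-+ (inP j) m (λ q → post q t)))
      Σpre≤1 : sumWhere (inP j) (λ q → pre q t) ≤ 1
      Σpre≤1 = ≤-trans (sumWhere-≤-single (inP j) (λ q → pre q t) s
                         (λ q q≢s q∈ → others q (≡ᵇ⇒≡ _ _ q∈) q≢s))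
                       (≤-reflexive pre≡1)
      Σpost≥1 : 1 ≤ sumWhere (inP j) (λ q → post q t)
      Σpost≥1 = ≤-trans (≤-reflexive (sym post≡1))
                        (≤-sumWhere (inP j) (λ q → post q t) s′ (≡⇒≡ᵇ _ _ ls′))

    mP-fire-mono : ∀ {m t} j → Enabled N m t → tlvl t ≢ suc j → mP m j ≤ mP (fire N m t) j
    mP-fire-mono {m} {t} j en t∉Tj+1 with tlvl t ≟ j
    ... | yes t∈Tj = mP-fire-ownLevel j en t∈Tj
    ... | no  t∉Tj = sumWhere-mono (inP j) λ p p∈ →
      let lp = ≡ᵇ⇒≡ (lvl p) j p∈ in
      unconsumed≤fire N m t p (pre≡0-unlessAdjacent t p (λ e → t∉Tj (trans e lp))
                                                   (λ e → t∉Tj+1 (trans e (cong suc lp))))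

  -- Indexed by the value of φ so that φ-spec can case-split along the definition of φ.
  data Φ-Spec (i : ℕ) (m : Marking N) (v : ℕ) : Set where
    unmarked : mP m i ≡ 0 → v ≡ maxPot i → Φ-Spec i m v
    marked   : ∀ a → lvl a ≡ i → 0 < m a → v ≡ pot a →
               (∀ b → lvl b ≡ i → 0 < m b → pot a ≤ pot b) → Φ-Spec i m v

  φ-spec : ∀ i m → Φ-Spec i m (φ i m)
  φ-spec i m with mP m i ≡ᵇ 0 in e
                | minWhere (λ p → inP i p ∧ not (m p ≡ᵇ 0)) pot
                | minWhere-spec (λ p → inP i p ∧ not (m p ≡ᵇ 0)) pot
  ... | true  | _ | _ = unmarked (≡ᵇ⇒≡ (mP m i) 0 (from T-≡ e)) refl
  ... | false | _ | some a a∈ v≡ v≤ with to T-∧ a∈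
  ...   | la , ma = marked a (≡ᵇ⇒≡ _ _ la) (T-nonzero⇒0< _ ma) v≡
                      λ b lb mb → subst (_≤ pot b) v≡
                                    (v≤ b (from T-∧ (≡⇒≡ᵇ _ _ lb , 0<⇒T-nonzero mb)))
  φ-spec i m | false | _ | none ¬marked = contradiction (trans (sym e) (cong (_≡ᵇ 0) mP≡0)) λ ()
    where
    empty : ∀ p → T (inP i p) → m p ≡ 0
    empty p p∈ with m p | ¬marked p
    ... | zero  | _  = refl
    ... | suc _ | ¬q = contradiction (from T-∧ (p∈ , _)) ¬q
    mP≡0 : mP m i ≡ 0
    mP≡0 = sumWhere-zero (inP i) empty

  φ≤pot : ∀ i m p → lvl p ≡ i → 0 < m p → φ i m ≤ pot p
  φ≤pot i m p lp mp with φ-spec i m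
  ... | unmarked mP≡0 _ =
    contradiction (≤-trans (≤-sumWhere (inP i) m p (≡⇒≡ᵇ _ _ lp)) (≤-reflexive mP≡0)) (<⇒≱ mp)
  ... | marked a _ _ φ≡ minimal = ≤-trans (≤-reflexive φ≡) (minimal p lp mp)

  φ≤maxPot : ∀ i m → φ i m ≤ maxPot i
  φ≤maxPot i m with φ-spec i m
  ... | unmarked _ φ≡       = ≤-reflexive φ≡
  ... | marked a la _ φ≡ _ = ≤-trans (≤-reflexive φ≡) (≤-maxWhere (inP i) pot a (≡⇒≡ᵇ _ _ la))

  module _ (Π³ : IsPi3) where
    open IsPi3 Π³
    open IsOrderedPi ordered

    φ-fire-≤ : ∀ j m t → tlvl t ≢ suc j → φ (suc j) (fire N m t) ≤ φ (suc j) m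
    φ-fire-≤ j m t t∉T with φ-spec (suc j) m
    ... | unmarked _ φ≡ = ≤-trans (φ≤maxPot (suc j) _) (≤-reflexive (sym φ≡))
    ... | marked a la ma φ≡ _ with pre a t in e
    ...   | zero  = ≤-trans (φ≤pot (suc j) _ a la (<-≤-trans ma (unconsumed≤fire N m t a e)))
                            (≤-reflexive (sym φ≡))
    ...   | suc _ = ≤-trans (φ≤maxPot (suc j) _) (≤-reflexive (sym (trans φ≡ pot-a≡max)))
      where
      t∈T′ : tlvl t ≡ suc (suc j)
      t∈T′ with pre-lvl t a (subst (0 <_) (sym e) (s≤s z≤n))
      ... | inj₁ eq = contradiction (trans (sym eq) la) t∉T
      ... | inj₂ eq = trans (sym eq) (cong suc la)
      pot-a≡max : pot a ≡ maxPot (suc j)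
      pot-a≡max = pi3 (suc j) (s≤s z≤n) (subst (_≤ n) t∈T′ (proj₂ (tlvl-range t))) a la
                      (t , t∈T′ , subst (0 <_) (sym e) (s≤s z≤n))

    φ-fire-ownLevel : ∀ j m t → tlvl t ≡ suc j → φ (suc j) (fire N m t) ≤ mP (fire N m t) j
    φ-fire-ownLevel j m t t∈T with sm-out t
    ... | p , lp , post≡1 , _ = begin
      φ (suc j) m′        ≤⟨ φ≤pot (suc j) m′ p lp′ (<-≤-trans pos (post≤fire N m t p)) ⟩
      pot p               ≤⟨ sumWhere-mono _ (λ q _ → potPQ≤post ordered t p q lp pos) ⟩
      postBelow (lvl p)   ≡⟨ cong postBelow lp′ ⟩
      postBelow (suc j)   ≤⟨ sumWhere-mono (inP j) (λ q _ → post≤fire N m t q) ⟩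
      mP m′ j             ∎
      where
      open ≤-Reasoning
      m′ : Marking N
      m′ = fire N m t
      postBelow : ℕ → ℕ
      postBelow l = sumWhere (λ q → suc (lvl q) ≡ᵇ l) (λ q → post q t)
      lp′ : lvl p ≡ suc j
      lp′ = trans lp t∈T
      pos : 0 < post p t
      pos = one-pos post≡1

    φ-invariant-fire : ∀ j {m t} → Enabled N m t → φ (suc j) m ≤ mP m j →
                       φ (suc j) (fire N m t) ≤ mP (fire N m t) j
    φ-invariant-fire j {m} {t} en inv with tlvl t ≟ suc j
    ... | yes t∈T = φ-fire-ownLevel j m t t∈T
    ... | no  t∉T = begin
      φ (suc j) (fire N m t) ≤⟨ φ-fire-≤ j m t t∉T ⟩
      φ (suc j) m            ≤⟨ inv ⟩
      mP m j                 ≤⟨ mP-fire-mono ordered j en t∉T ⟩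
      mP (fire N m t) j      ∎
      where open ≤-Reasoning

    φ-invariant : ∀ j {m m′} → Reach N m m′ → φ (suc j) m ≤ mP m j → φ (suc j) m′ ≤ mP m′ j
    φ-invariant j here          inv = inv
    φ-invariant j (step t r en) inv = φ-invariant-fire j en (φ-invariant j r inv)

lemma3 : (N : Net) (n : ℕ) (lvl : Fin (Net.np N) → ℕ) (tlvl : Fin (Net.nt N) → ℕ) →
         Levels.IsPi3 N n lvl tlvl →
         ∀ i → 2 ≤ i → i ≤ n →
         ∀ (m : Marking N) → Levels.φ N n lvl tlvl i m ≤ Levels.mP N n lvl tlvl m (i ∸ 1) →
         ∀ (m' : Marking N) → Reach N m m' →
         Levels.φ N n lvl tlvl i m' ≤ Levels.mP N n lvl tlvl m' (i ∸ 1)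
lemma3 N n lvl tlvl Π³ (suc (suc j)) (s≤s (s≤s z≤n)) _ m inv m′ r =
  φ-invariant N n lvl tlvl Π³ (suc j) r inv
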